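{- Let $k$ be an integer, and let $G$ be a $K_k$-free graph with $G\rightarrow(K_{k-1},K_{k-1})^v$ and $|V(G)|=F_v(k-1,k-1;k)$. Let $f(G)$ be the largest number of vertices of a $K_{k-1}$-free induced subgraph of $G$. Then $$F_v(J_k,J_k;k)\le 3F_v(k-1,k-1;k)-f(G).$$
   Context: $J_k=K_k-e$, the complete graph on $k$ vertices with one edge removed. For graphs $G,H_1,H_2$, $G\rightarrow(H_1,H_2)^v$ means that for every partition $V(G)=X_1\cup X_2$ there is $i$ such that the subgraph induced by $X_i$ contains a copy of $H_i$. An integer $a$ in place of a graph stands for $K_a$. $F_v(H_1,H_2;m)$ is the smallest number of vertices of a $K_m$-free graph $G$ with $G\rightarrow(H_1,H_2)^v$. -}

module Defs where

open import Data.Nat using (ℕ; _≤_; _*_; _∸_)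
open import Data.Bool using (Bool; true; false; not; _∧_)
open import Data.Fin using (Fin; toℕ)
open import Data.Fin.Subset using (Subset; _∈_; ∁; ∣_∣)
open import Data.Product using (Σ; _×_; ∃)
open import Data.Sum using (_⊎_)
open import Data.Empty using (⊥)
open import Relation.Nullary using (¬_)
open import Relation.Nullary.Decidable using (⌊_⌋)
open import Relation.Binary.PropositionalEquality using (_≡_)
open import Data.Fin using (_≟_)
open import Function.Definitions using (Injective)

record Graph (n : ℕ) : Set where
  field
    adj    : Fin n → Fin n → Bool
    adj-sym    : ∀ i j → adj i j ≡ adj j i
    adj-irrefl : ∀ i → adj i i ≡ false
open Graph public

K : (a : ℕ) → Graph a
K a = record { adj = λ i j → not ⌊ i ≟ j ⌋ ; adj-sym = s ; adj-irrefl = r }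
  where
  open import Relation.Binary.PropositionalEquality using (refl; sym)
  open import Relation.Nullary using (yes; no)
  s : ∀ i j → not ⌊ i ≟ j ⌋ ≡ not ⌊ j ≟ i ⌋
  s i j with i ≟ j | j ≟ i
  ... | yes _ | yes _ = refl
  ... | no _  | no _  = refl
  ... | yes p | no q  = Data.Empty.⊥-elim (q (sym p))
    where import Data.Empty
  ... | no q  | yes p = Data.Empty.⊥-elim (q (sym p))
    where import Data.Empty
  r : ∀ i → not ⌊ i ≟ i ⌋ ≡ false
  r i with i ≟ i
  ... | yes _ = refl
  ... | no q  = Data.Empty.⊥-elim (q refl)
    where import Data.Empty

isE01 : ∀ {k} → Fin k → Fin k → Bool
isE01 i j = (⌊ toℕ i Data.Nat.≟ 0 ⌋ ∧ ⌊ toℕ j Data.Nat.≟ 1 ⌋)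
            Data.Bool.∨ (⌊ toℕ i Data.Nat.≟ 1 ⌋ ∧ ⌊ toℕ j Data.Nat.≟ 0 ⌋)
  where import Data.Nat
        import Data.Bool

-- J_k = K_k - e, with e = {0,1} (meaningful for k ≥ 2).
J : (k : ℕ) → Graph k
J k = record
  { adj = λ i j → adj (K k) i j ∧ not (isE01 i j)
  ; adj-sym = s
  ; adj-irrefl = λ i → Relation.Binary.PropositionalEquality.cong (_∧ not (isE01 i i)) (adj-irrefl (K k) i)
  }
  where
  import Relation.Binary.PropositionalEquality
  open Relation.Binary.PropositionalEquality using (cong₂; refl)
  s : ∀ i j → adj (K k) i j ∧ not (isE01 i j) ≡ adj (K k) j i ∧ not (isE01 j i)
  s i j = cong₂ (λ a b → a ∧ not b) (adj-sym (K k) i j) (e i j)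
    where
    open import Data.Bool.Properties using (∧-comm; ∨-comm)
    e : ∀ i j → isE01 {k} i j ≡ isE01 j i
    e i j with ⌊ toℕ i Data.Nat.≟ 0 ⌋ | ⌊ toℕ j Data.Nat.≟ 1 ⌋ | ⌊ toℕ i Data.Nat.≟ 1 ⌋ | ⌊ toℕ j Data.Nat.≟ 0 ⌋
      where import Data.Nat
    ... | a | b | c | d = Relation.Binary.PropositionalEquality.trans
            (∨-comm (a ∧ b) (c ∧ d))
            (cong₂ Data.Bool._∨_ (∧-comm c d) (∧-comm a b))
      where import Data.Bool

CopyIn : ∀ {h n} → Graph h → Graph n → Subset n → Set
CopyIn {h} {n} H G X =
  Σ (Fin h → Fin n) λ φ →
    Injective _≡_ _≡_ φ
    × (∀ i j → adj H i j ≡ true → adj G (φ i) (φ j) ≡ true)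
    × (∀ i → φ i ∈ X)

Contains : ∀ {h n} → Graph h → Graph n → Set
Contains {n = n} H G = CopyIn H G Data.Fin.Subset.⊤
  where import Data.Fin.Subset

KFree : ∀ {n} → ℕ → Graph n → Set
KFree m G = ¬ Contains (K m) G

Arrows : ∀ {n h₁ h₂} → Graph n → Graph h₁ → Graph h₂ → Set
Arrows G H₁ H₂ = ∀ X → CopyIn H₁ G X ⊎ CopyIn H₂ G (∁ X)

IsFv : ∀ {h₁ h₂} → Graph h₁ → Graph h₂ → ℕ → ℕ → Set
IsFv H₁ H₂ m N =
  (Σ (Graph N) λ G → KFree m G × Arrows G H₁ H₂)
  × (∀ n (G : Graph n) → KFree m G → Arrows G H₁ H₂ → N ≤ n)

InducedKFree : ∀ {n} → ℕ → Graph n → Subset n → Set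
InducedKFree a G S = ¬ CopyIn (K a) G S

IsLargestKFree : ∀ {n} → ℕ → Graph n → ℕ → Set
IsLargestKFree {n} a G f =
  (Σ (Subset n) λ S → InducedKFree a G S × ∣ S ∣ ≡ f)
  × (∀ S → InducedKFree a G S → ∣ S ∣ ≤ f)

-- Take a K_k-free G with G → (K_{k-1}, K_{k-1})^v and a K_{k-1}-free induced subgraph A with f vertices.
-- Blow up G by giving every vertex two copies and every vertex outside A a third one, copies of one vertex
-- being non-adjacent; the result has 3n − f vertices and is still K_k-free.  Colour a vertex of G by the
-- colour of its first copy if it lies in A and by the majority colour of its three copies otherwise.  A
-- monochromatic K_{k-1} of G cannot lie inside A, so one of its vertices has two copies of its colour;
-- these two copies together with one copy of each other clique vertex form a monochromatic J_k, its missing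
-- edge joining the two copies.  Hence F_v(J_k, J_k; k) ≤ 3n − f, the minimum existing since the finitely
-- many graphs of each order can be searched exhaustively.
module Submission where

open import Data.Bool using (Bool; true; false; not)
open import Data.Bool.Properties using (∧-conicalˡ) renaming (_≟_ to _≟ᵇ_)
open import Data.Empty using (⊥-elim)
open import Data.Fin using (Fin; zero; suc; _↑ˡ_; _↑ʳ_; splitAt; punchIn; _≟_)
open import Data.Fin.Properties
  using (any?; all?; ¬∀⟶∃¬; splitAt-↑ˡ; splitAt-↑ʳ; ↑ʳ-injective; punchIn-injective; punchInᵢ≢i)
open import Data.Fin.Subset using (Subset; _∈_; _∉_; ∁; ∣_∣; ⊤)
open import Data.Fin.Subset.Properties
  using (_∈?_; anySubset?; x∉p⇒x∈∁p; x∈∁p⇒x∉p; ∣∁p∣≡n∸∣p∣; ∣p∣≤n; ∈⊤)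
open import Data.Nat using (ℕ; zero; suc; _+_; _*_; _∸_; _≤_; _<_; s≤s)
open import Data.Nat.Induction using (<-rec)
open import Data.Nat.Properties using (anyUpTo?; ≮⇒≥; +-∸-assoc; +-identityʳ; ≤-trans; ≤-reflexive; m≤m+n)
open import Data.Product using (Σ; ∃; ∃₂; _×_; _,_; proj₁; proj₂)
open import Data.Sum using (_⊎_; inj₁; inj₂; [_,_]′)
import Data.Sum as Sum
open import Data.Vec using (Vec; []; _∷_; lookup; tabulate; here; there)
open import Data.Vec.Properties using (lookup∘tabulate; []=⇒lookup; lookup⇒[]=)
open import Function using (id; _∘_; case_of_)
open import Function.Definitions using (Injective)
open import Relation.Binary.PropositionalEquality
  using (_≡_; _≢_; _≗_; refl; sym; trans; cong; cong₂; subst; module ≡-Reasoning)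
open import Relation.Nullary using (Dec; yes; no)
open import Relation.Nullary.Decidable
  using (map′; ¬?; _×-dec_; _⊎-dec_; _→-dec_; decidable-stable)
open import Relation.Unary using (Decidable)

open import Defs

Searchable : Set → Set₁
Searchable A = ∀ {P : A → Set} → Decidable P → Dec (∃ P)

searchBool : Searchable Bool
searchBool {P} P? = map′ [ (true ,_) , (false ,_) ]′ split (P? true ⊎-dec P? false)
  where
  split : ∃ P → P true ⊎ P false
  split (true  , p) = inj₁ p
  split (false , p) = inj₂ p

searchFin : ∀ {n} → Searchable (Fin n)
searchFin = any?

searchVec : ∀ {A n} → Searchable A → Searchable (Vec A n)
searchVec {n = zero} _ P? = map′ ([] ,_) (λ { ([] , p) → p }) (P? [])
searchVec {n = suc _} search {P} P? =
  map′ (λ (x , xs , p) → x ∷ xs , p) (λ { (x ∷ xs , p) → x , xs , p })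
       (search {λ x → ∃ λ xs → P (x ∷ xs)} λ x → searchVec search (P? ∘ (x ∷_)))

least-witness : ∀ {P : ℕ → Set} → Decidable P → ∀ {n} → P n → ∃ λ m → P m × (∀ {k} → P k → m ≤ k)
least-witness {P} P? {n} = <-rec (λ n → P n → Least) step n
  where
  Least : Set
  Least = ∃ λ m → P m × (∀ {k} → P k → m ≤ k)
  step : ∀ n → (∀ {m} → m < n → P m → Least) → P n → Least
  step n below pn with anyUpTo? P? n
  ... | yes (m , m<n , pm) = below m<n pm
  ... | no none            = n , pn , λ {k} pk → ≮⇒≥ λ k<n → none (k , k<n , pk)

IsCopy : ∀ {h n} → Graph h → Graph n → Subset n → (Fin h → Fin n) → Set
IsCopy H G X φ =
  Injective _≡_ _≡_ φ × (∀ i j → adj H i j ≡ true → adj G (φ i) (φ j) ≡ true) × (∀ i → φ i ∈ X)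

IsCopy-cong : ∀ {h n} (H : Graph h) (G : Graph n) {X} {φ ψ : Fin h → Fin n}
  → φ ≗ ψ → IsCopy H G X φ → IsCopy H G X ψ
IsCopy-cong H G {X} φ≗ψ (inj , edge , mem) =
    (λ {i} {j} e → inj (trans (φ≗ψ i) (trans e (sym (φ≗ψ j)))))
  , (λ i j e → subst (_≡ true) (cong₂ (adj G) (φ≗ψ i) (φ≗ψ j)) (edge i j e))
  , λ i → subst (_∈ X) (φ≗ψ i) (mem i)

record SameAdj {n} (G G′ : Graph n) : Set where
  field adj-≡ : ∀ i j → adj G i j ≡ adj G′ i j
open SameAdj

≡⇒SameAdj : ∀ {n} {G G′ : Graph n} → adj G ≡ adj G′ → SameAdj G G′
≡⇒SameAdj refl = record { adj-≡ = λ _ _ → refl }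

SameAdj-sym : ∀ {n} {G G′ : Graph n} → SameAdj G G′ → SameAdj G′ G
SameAdj-sym G≈G′ = record { adj-≡ = λ i j → sym (adj-≡ G≈G′ i j) }

CopyIn-resp : ∀ {h n} (H : Graph h) {G G′ : Graph n} {X} → SameAdj G G′ → CopyIn H G X → CopyIn H G′ X
CopyIn-resp H G≈G′ (φ , inj , edge , mem) =
  φ , inj , (λ i j e → trans (sym (adj-≡ G≈G′ (φ i) (φ j))) (edge i j e)) , mem

IsCopy? : ∀ {h n} (H : Graph h) (G : Graph n) X → Decidable (IsCopy H G X)
IsCopy? H G X φ = injective? ×-dec edges? ×-dec all? (λ i → φ i ∈? X)
  where
  injective? : Dec (Injective _≡_ _≡_ φ)
  injective? = map′ (λ inj {i} {j} → inj i j) (λ inj i j → inj)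
                    (all? λ i → all? λ j → (φ i ≟ φ j) →-dec (i ≟ j))
  edges? : Dec (∀ i j → adj H i j ≡ true → adj G (φ i) (φ j) ≡ true)
  edges? = all? λ i → all? λ j → (adj H i j ≟ᵇ true) →-dec (adj G (φ i) (φ j) ≟ᵇ true)

copyIn? : ∀ {h n} (H : Graph h) (G : Graph n) X → Dec (CopyIn H G X)
copyIn? H G X =
  map′ (λ (v , copy) → lookup v , copy)
       (λ (φ , copy) → tabulate φ , IsCopy-cong H G {φ = φ} (sym ∘ lookup∘tabulate φ) copy)
       (searchVec searchFin (IsCopy? H G X ∘ lookup))

arrows? : ∀ {n h₁ h₂} (G : Graph n) (H₁ : Graph h₁) (H₂ : Graph h₂) → Dec (Arrows G H₁ H₂)
arrows? G H₁ H₂ =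
  map′ (λ ¬bad X → decidable-stable (split? X) λ ¬split → ¬bad (X , ¬split))
       (λ arr (X , ¬split) → ¬split (arr X))
       (¬? (anySubset? (¬? ∘ split?)))
  where
  split? : ∀ X → Dec (CopyIn H₁ G X ⊎ CopyIn H₂ G (∁ X))
  split? X = copyIn? H₁ G X ⊎-dec copyIn? H₂ G (∁ X)

-- Graphs are searched through their adjacency matrices; P must respect SameAdj because the
-- symmetry and irreflexivity proofs inside a Graph are not unique.
graph? : ∀ {n} {P : Graph n → Set} → (∀ {G G′} → SameAdj G G′ → P G → P G′) → Decidable P → Dec (∃ P)
graph? {n} {P} P-resp P? =
  map′ (λ (M , sym-M , irr-M , p) → fromMatrix M sym-M irr-M , p)
       (λ (G , p) → matrix G , matrix-sym G , matrix-irrefl G , P-resp (matrix-adj G) p)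
       (searchVec (searchVec searchBool) Q?)
  where
  Matrix : Set
  Matrix = Vec (Vec Bool n) n
  entry : Matrix → Fin n → Fin n → Bool
  entry M i j = lookup (lookup M i) j
  fromMatrix : ∀ M → (∀ i j → entry M i j ≡ entry M j i) → (∀ i → entry M i i ≡ false) → Graph n
  fromMatrix M s r = record { adj = entry M ; adj-sym = s ; adj-irrefl = r }
  Q : Matrix → Set
  Q M = Σ (∀ i j → entry M i j ≡ entry M j i) λ s → Σ (∀ i → entry M i i ≡ false) λ r → P (fromMatrix M s r)
  Q? : Decidable Q
  Q? M with all? (λ i → all? λ j → entry M i j ≟ᵇ entry M j i) | all? (λ i → entry M i i ≟ᵇ false)
  ... | no ¬s | _     = no (¬s ∘ proj₁)
  ... | yes _ | no ¬r = no (¬r ∘ proj₁ ∘ proj₂)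
  ... | yes s | yes r =
    map′ (λ p → s , r , p) (λ (_ , _ , p) → P-resp (≡⇒SameAdj refl) p) (P? (fromMatrix M s r))
  matrix : Graph n → Matrix
  matrix G = tabulate λ i → tabulate (adj G i)
  entry-matrix : ∀ G i j → entry (matrix G) i j ≡ adj G i j
  entry-matrix G i j = trans (cong (λ row → lookup row j) (lookup∘tabulate _ i)) (lookup∘tabulate (adj G i) j)
  matrix-sym : ∀ G i j → entry (matrix G) i j ≡ entry (matrix G) j i
  matrix-sym G i j = trans (entry-matrix G i j) (trans (adj-sym G i j) (sym (entry-matrix G j i)))
  matrix-irrefl : ∀ G i → entry (matrix G) i i ≡ false
  matrix-irrefl G i = trans (entry-matrix G i i) (adj-irrefl G i)
  matrix-adj : ∀ G → SameAdj G (fromMatrix (matrix G) (matrix-sym G) (matrix-irrefl G))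
  matrix-adj G = record { adj-≡ = λ i j → sym (entry-matrix G i j) }

Fv-exists : ∀ {h₁ h₂ n} m (H₁ : Graph h₁) (H₂ : Graph h₂) (G : Graph n) → KFree m G → Arrows G H₁ H₂
  → ∃ λ F → IsFv H₁ H₂ m F × F ≤ n
Fv-exists m H₁ H₂ G G-free G-arr =
  let F , witness , least = least-witness (λ N → graph? {P = Good} resp (good? N)) (G , G-free , G-arr)
  in F , (witness , λ _ G′ free arr → least (G′ , free , arr)) , least (G , G-free , G-arr)
  where
  Good : ∀ {N} → Graph N → Set
  Good G = KFree m G × Arrows G H₁ H₂
  good? : ∀ N → Decidable (Good {N})
  good? N G = ¬? (copyIn? (K m) G ⊤) ×-dec arrows? G H₁ H₂
  resp : ∀ {N} {G G′ : Graph N} → SameAdj G G′ → Good G → Good G′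
  resp G≈G′ (free , arr) =
      (free ∘ CopyIn-resp (K m) (SameAdj-sym G≈G′))
    , λ X → Sum.map (CopyIn-resp H₁ G≈G′) (CopyIn-resp H₂ G≈G′) (arr X)

adj⇒≢ : ∀ {n} (G : Graph n) {u v} → adj G u v ≡ true → u ≢ v
adj⇒≢ G {u} e refl = case trans (sym (adj-irrefl G u)) e of λ ()

≢⇒K-adj : ∀ {k} {i j : Fin k} → i ≢ j → adj (K k) i j ≡ true
≢⇒K-adj {i = i} {j} i≢j with i ≟ j
... | yes i≡j = ⊥-elim (i≢j i≡j)
... | no  _   = refl

J-adj⇒≢ : ∀ {k} (i j : Fin k) → adj (J k) i j ≡ true → i ≢ j
J-adj⇒≢ {k} i j e = adj⇒≢ (K k) (∧-conicalˡ (adj (K k) i j) (not (isE01 i j)) e)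

K-hom-injective : ∀ {m n} (G : Graph n) {φ : Fin m → Fin n}
  → (∀ i j → adj (K m) i j ≡ true → adj G (φ i) (φ j) ≡ true) → Injective _≡_ _≡_ φ
K-hom-injective G edge {i} {j} e with i ≟ j
... | yes i≡j = i≡j
... | no  i≢j = ⊥-elim (adj⇒≢ G (edge i j (≢⇒K-adj i≢j)) e)

pullback : ∀ {n N} → Graph n → (Fin N → Fin n) → Graph N
pullback G π = record
  { adj        = λ x y → adj G (π x) (π y)
  ; adj-sym    = λ x y → adj-sym G (π x) (π y)
  ; adj-irrefl = adj-irrefl G ∘ π
  }

pullback-KFree : ∀ {m n N} (G : Graph n) (π : Fin N → Fin n) → KFree m G → KFree m (pullback G π)
pullback-KFree G π G-free (φ , _ , edge , _) = G-free (π ∘ φ , K-hom-injective G edge , edge , λ _ → ∈⊤)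

module _ {N n} (π : Fin N → Fin n) where

  Lift : Subset N → Fin n → Set
  Lift Z v = ∃ λ x → π x ≡ v × x ∈ Z

  DoubleLift : Subset N → Fin n → Set
  DoubleLift Z v = ∃₂ λ x x′ → x ≢ x′ × (π x ≡ v × x ∈ Z) × (π x′ ≡ v × x′ ∈ Z)

  Covers : Subset n → Subset n → Subset N → Set
  Covers A W Z = ∀ {v} → v ∈ W → Lift Z v × (v ∉ A → DoubleLift Z v)

-- Vertices 0 and 1 of J, the ends of its missing edge, both go to i₀.
merge : ∀ {m} → Fin (suc m) → Fin (suc (suc m)) → Fin (suc m)
merge i₀ zero          = i₀
merge i₀ (suc zero)    = i₀
merge i₀ (suc (suc j)) = punchIn i₀ j

merge-J-adj : ∀ {m} i₀ (i j : Fin (suc (suc m))) → adj (J (suc (suc m))) i j ≡ true → merge i₀ i ≢ merge i₀ j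
merge-J-adj {m} i₀ zero          zero          e   = ⊥-elim (J-adj⇒≢ {suc (suc m)} zero zero e refl)
merge-J-adj {m} i₀ (suc zero)    (suc zero)    e   = ⊥-elim (J-adj⇒≢ {suc (suc m)} (suc zero) (suc zero) e refl)
merge-J-adj     i₀ zero          (suc zero)    ()
merge-J-adj     i₀ (suc zero)    zero          ()
merge-J-adj     i₀ zero          (suc (suc j)) _ q = punchInᵢ≢i i₀ j (sym q)
merge-J-adj     i₀ (suc zero)    (suc (suc j)) _ q = punchInᵢ≢i i₀ j (sym q)
merge-J-adj     i₀ (suc (suc i)) zero          _ q = punchInᵢ≢i i₀ i q
merge-J-adj     i₀ (suc (suc i)) (suc zero)    _ q = punchInᵢ≢i i₀ i q
merge-J-adj     i₀ (suc (suc i)) (suc (suc j)) e q =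
  J-adj⇒≢ (suc (suc i)) (suc (suc j)) e (cong (λ k → suc (suc k)) (punchIn-injective i₀ i j q))

J-copy-in-pullback : ∀ {m n N} (G : Graph n) (π : Fin N → Fin n) {Z} {ψ : Fin (suc m) → Fin n}
  → Injective _≡_ _≡_ ψ → (∀ i j → adj (K (suc m)) i j ≡ true → adj G (ψ i) (ψ j) ≡ true)
  → (i₀ : Fin (suc m)) → DoubleLift π Z (ψ i₀) → (∀ i → Lift π Z (ψ i))
  → CopyIn (J (suc (suc m))) (pullback G π) Z
J-copy-in-pullback {m} {N = N} G π {Z} {ψ} ψ-inj ψ-edge i₀ (a , b , a≢b , (πa , a∈Z) , (πb , b∈Z)) lift =
  φ , φ-inj , φ-edge , φ∈Z
  where
  φ : Fin (suc (suc m)) → Fin N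
  φ zero          = a
  φ (suc zero)    = b
  φ (suc (suc j)) = proj₁ (lift (punchIn i₀ j))
  πφ : ∀ i → π (φ i) ≡ ψ (merge i₀ i)
  πφ zero          = πa
  πφ (suc zero)    = πb
  πφ (suc (suc j)) = proj₁ (proj₂ (lift (punchIn i₀ j)))
  φ∈Z : ∀ i → φ i ∈ Z
  φ∈Z zero          = a∈Z
  φ∈Z (suc zero)    = b∈Z
  φ∈Z (suc (suc j)) = proj₂ (proj₂ (lift (punchIn i₀ j)))
  φ-edge : ∀ i j → adj (J (suc (suc m))) i j ≡ true → adj G (π (φ i)) (π (φ j)) ≡ true
  φ-edge i j e = subst (_≡ true) (sym (cong₂ (adj G) (πφ i) (πφ j)))
                       (ψ-edge _ _ (≢⇒K-adj (merge-J-adj i₀ i j e)))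
  merge-φ-injective : ∀ i j → merge i₀ i ≡ merge i₀ j → φ i ≡ φ j → i ≡ j
  merge-φ-injective zero          zero          _ _ = refl
  merge-φ-injective (suc zero)    (suc zero)    _ _ = refl
  merge-φ-injective zero          (suc zero)    _ e = ⊥-elim (a≢b e)
  merge-φ-injective (suc zero)    zero          _ e = ⊥-elim (a≢b (sym e))
  merge-φ-injective zero          (suc (suc j)) q _ = ⊥-elim (punchInᵢ≢i i₀ j (sym q))
  merge-φ-injective (suc zero)    (suc (suc j)) q _ = ⊥-elim (punchInᵢ≢i i₀ j (sym q))
  merge-φ-injective (suc (suc i)) zero          q _ = ⊥-elim (punchInᵢ≢i i₀ i q)
  merge-φ-injective (suc (suc i)) (suc zero)    q _ = ⊥-elim (punchInᵢ≢i i₀ i q)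
  merge-φ-injective (suc (suc i)) (suc (suc j)) q _ = cong (λ k → suc (suc k)) (punchIn-injective i₀ i j q)
  φ-inj : Injective _≡_ _≡_ φ
  φ-inj {i} {j} e = merge-φ-injective i j (ψ-inj (trans (sym (πφ i)) (trans (cong π e) (πφ j)))) e

Covers-lifts-clique : ∀ {m n N} (G : Graph n) (π : Fin N → Fin n) {A W Z}
  → InducedKFree (suc m) G A → Covers π A W Z
  → CopyIn (K (suc m)) G W → CopyIn (J (suc (suc m))) (pullback G π) Z
Covers-lifts-clique G π {A} A-free cover (ψ , ψ-inj , ψ-edge , ψ∈W)
  with ¬∀⟶∃¬ _ (λ i → ψ i ∈ A) (λ i → ψ i ∈? A) (λ ψ⊆A → A-free (ψ , ψ-inj , ψ-edge , ψ⊆A))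
... | i₀ , ψi₀∉A =
  J-copy-in-pullback G π ψ-inj ψ-edge i₀ (proj₂ (cover (ψ∈W i₀)) ψi₀∉A) (λ i → proj₁ (cover (ψ∈W i)))

pullback-arrows : ∀ {m n N} (G : Graph n) (π : Fin N → Fin n) (A : Subset n)
  → InducedKFree (suc m) G A → Arrows G (K (suc m)) (K (suc m))
  → (∀ X → ∃ λ Y → Covers π A Y X × Covers π A (∁ Y) (∁ X))
  → Arrows (pullback G π) (J (suc (suc m))) (J (suc (suc m)))
pullback-arrows G π A A-free G-arr cover X =
  let Y , Y-covers , ∁Y-covers = cover X
  in Sum.map (Covers-lifts-clique G π A-free Y-covers) (Covers-lifts-clique G π A-free ∁Y-covers) (G-arr Y)

enum : ∀ {n} (S : Subset n) → Fin ∣ S ∣ → Fin n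
enum (true  ∷ S) zero    = zero
enum (true  ∷ S) (suc j) = suc (enum S j)
enum (false ∷ S) j       = suc (enum S j)

enum-onto : ∀ {n} (S : Subset n) {v} → v ∈ S → ∃ λ j → enum S j ≡ v
enum-onto (true  ∷ S) here = zero , refl
enum-onto (true  ∷ S) (there v∈S) = let j , e = enum-onto S v∈S in suc j , cong suc e
enum-onto (false ∷ S) (there v∈S) = let j , e = enum-onto S v∈S in j , cong suc e

majority : Bool → Bool → Bool → Bool
majority true  true  _ = true
majority false false _ = false
majority _     _     d = d

majority-agrees : ∀ a b d {c} → majority a b d ≡ c → (a ≡ c × b ≡ c) ⊎ (a ≡ c × d ≡ c) ⊎ (b ≡ c × d ≡ c)
majority-agrees true  true  _     refl = inj₁ (refl , refl)
majority-agrees false false _     refl = inj₁ (refl , refl)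
majority-agrees true  false true  refl = inj₂ (inj₁ (refl , refl))
majority-agrees true  false false refl = inj₂ (inj₂ (refl , refl))
majority-agrees false true  true  refl = inj₂ (inj₂ (refl , refl))
majority-agrees false true  false refl = inj₂ (inj₁ (refl , refl))

_⟨_⟩ : ∀ {n} → Subset n → Bool → Subset n
X ⟨ true  ⟩ = X
X ⟨ false ⟩ = ∁ X

lookup⇒∈⟨⟩ : ∀ {n} (X : Subset n) {x c} → lookup X x ≡ c → x ∈ X ⟨ c ⟩
lookup⇒∈⟨⟩ X {x} {true}  e = lookup⇒[]= x X e
lookup⇒∈⟨⟩ X {x} {false} e = x∉p⇒x∈∁p λ x∈X → case trans (sym ([]=⇒lookup x∈X)) e of λ ()

∈⟨⟩⇒lookup : ∀ {n} (X : Subset n) {x c} → x ∈ X ⟨ c ⟩ → lookup X x ≡ c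
∈⟨⟩⇒lookup X {x} {true}  x∈X = []=⇒lookup x∈X
∈⟨⟩⇒lookup X {x} {false} x∈∁X with lookup X x in eq
... | true  = ⊥-elim (x∈∁p⇒x∉p x∈∁X (lookup⇒[]= x X eq))
... | false = refl

↑ˡ≢↑ʳ : ∀ {m} n (i : Fin m) (j : Fin n) → i ↑ˡ n ≢ m ↑ʳ j
↑ˡ≢↑ʳ {m} n i j e =
  case trans (sym (splitAt-↑ˡ m i n)) (trans (cong (splitAt m) e) (splitAt-↑ʳ m n j)) of λ ()

module Tripling {n} (A : Subset n) where

  order : ℕ
  order = n + (n + ∣ ∁ A ∣)

  first second : Fin n → Fin order
  first  v = v ↑ˡ (n + ∣ ∁ A ∣)
  second v = n ↑ʳ (v ↑ˡ ∣ ∁ A ∣)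

  third : Fin ∣ ∁ A ∣ → Fin order
  third j = n ↑ʳ (n ↑ʳ j)

  proj : Fin order → Fin n
  proj x = [ id , [ id , enum (∁ A) ]′ ∘ splitAt n ]′ (splitAt n x)

  proj-first : ∀ v → proj (first v) ≡ v
  proj-first v rewrite splitAt-↑ˡ n v (n + ∣ ∁ A ∣) = refl

  proj-second : ∀ v → proj (second v) ≡ v
  proj-second v rewrite splitAt-↑ʳ n (n + ∣ ∁ A ∣) (v ↑ˡ ∣ ∁ A ∣) | splitAt-↑ˡ n v ∣ ∁ A ∣ = refl

  proj-third : ∀ j → proj (third j) ≡ enum (∁ A) j
  proj-third j rewrite splitAt-↑ʳ n (n + ∣ ∁ A ∣) (n ↑ʳ j) | splitAt-↑ʳ n ∣ ∁ A ∣ j = refl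

  ∁A-index : ∀ {v} → v ∉ A → ∃ λ j → enum (∁ A) j ≡ v
  ∁A-index v∉A = enum-onto (∁ A) (x∉p⇒x∈∁p v∉A)

  first≢second : ∀ v w → first v ≢ second w
  first≢second v w = ↑ˡ≢↑ʳ _ v _

  first≢third : ∀ v j → first v ≢ third j
  first≢third v j = ↑ˡ≢↑ʳ _ v _

  second≢third : ∀ v j → second v ≢ third j
  second≢third v j = ↑ˡ≢↑ʳ _ v j ∘ ↑ʳ-injective n _ _

  module _ (X : Subset order) where

    colour : Fin n → Bool
    colour v with v ∈? A
    ... | yes _   = lookup X (first v)
    ... | no  v∉A = majority (lookup X (first v)) (lookup X (second v))
                             (lookup X (third (proj₁ (∁A-index v∉A))))

    double-lift-of : ∀ {x x′ v c} → x ≢ x′ → proj x ≡ v → proj x′ ≡ v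
      → lookup X x ≡ c → lookup X x′ ≡ c → DoubleLift proj (X ⟨ c ⟩) v
    double-lift-of x≢x′ πx πx′ x-c x′-c = _ , _ , x≢x′ , (πx , lookup⇒∈⟨⟩ X x-c) , (πx′ , lookup⇒∈⟨⟩ X x′-c)

    majority-lift : ∀ {v c} j → enum (∁ A) j ≡ v
      → majority (lookup X (first v)) (lookup X (second v)) (lookup X (third j)) ≡ c
      → DoubleLift proj (X ⟨ c ⟩) v
    majority-lift {v} j enum-j e = case majority-agrees _ _ _ e of λ where
        (inj₁ (c₁ , c₂))        → double-lift-of (first≢second v v) (proj-first v) (proj-second v) c₁ c₂
        (inj₂ (inj₁ (c₁ , c₃))) → double-lift-of (first≢third v j) (proj-first v) proj-third-v c₁ c₃
        (inj₂ (inj₂ (c₂ , c₃))) → double-lift-of (second≢third v j) (proj-second v) proj-third-v c₂ c₃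
      where
      proj-third-v : proj (third j) ≡ v
      proj-third-v = trans (proj-third j) enum-j

    double-lift : ∀ {v c} → v ∉ A → colour v ≡ c → DoubleLift proj (X ⟨ c ⟩) v
    double-lift {v} v∉A e with v ∈? A
    ... | yes v∈A  = ⊥-elim (v∉A v∈A)
    ... | no  v∉A′ = majority-lift _ (proj₂ (∁A-index v∉A′)) e

    lift : ∀ {v c} → colour v ≡ c → Lift proj (X ⟨ c ⟩) v
    lift {v} e with v ∈? A
    ... | yes _   = first v , proj-first v , lookup⇒∈⟨⟩ X e
    ... | no  v∉A =
      let x , _ , _ , x-lifts , _ = majority-lift _ (proj₂ (∁A-index v∉A)) e in x , x-lifts

    colour-covers : ∀ c → Covers proj A (tabulate colour ⟨ c ⟩) (X ⟨ c ⟩)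
    colour-covers c {v} v∈Y = lift colour≡c , λ v∉A → double-lift v∉A colour≡c
      where
      colour≡c : colour v ≡ c
      colour≡c = trans (sym (lookup∘tabulate colour v)) (∈⟨⟩⇒lookup (tabulate colour) v∈Y)

  tripling-covers : ∀ X → ∃ λ Y → Covers proj A Y X × Covers proj A (∁ Y) (∁ X)
  tripling-covers X = tabulate (colour X) , colour-covers X true , colour-covers X false

n+[n+[n∸f]]≡3*n∸f : ∀ n {f} → f ≤ n → n + (n + (n ∸ f)) ≡ 3 * n ∸ f
n+[n+[n∸f]]≡3*n∸f n {f} f≤n = begin
  n + (n + (n ∸ f))  ≡⟨ cong (n +_) (sym (+-∸-assoc n f≤n)) ⟩
  n + (n + n ∸ f)    ≡⟨ sym (+-∸-assoc n (≤-trans f≤n (m≤m+n n n))) ⟩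
  n + (n + n) ∸ f    ≡⟨ cong (λ x → n + (n + x) ∸ f) (sym (+-identityʳ n)) ⟩
  3 * n ∸ f          ∎
  where open ≡-Reasoning

theorem6 : (k : ℕ) → 2 ≤ k → (n : ℕ) → (G : Graph n)
    → KFree k G → Arrows G (K (k ∸ 1)) (K (k ∸ 1)) → IsFv (K (k ∸ 1)) (K (k ∸ 1)) k n
    → (f : ℕ) → IsLargestKFree (k ∸ 1) G f
    → Σ ℕ λ F → IsFv (J k) (J k) k F × F ≤ 3 * n ∸ f
theorem6 (suc zero) (s≤s ())
theorem6 (suc (suc m)) _ n G G-free G-arr _ f ((A , A-free , ∣A∣≡f) , _) =
  let F , F-isFv , F≤order = Fv-exists (suc (suc m)) (J (suc (suc m))) (J (suc (suc m))) (pullback G proj)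
                               (pullback-KFree G proj G-free)
                               (pullback-arrows G proj A A-free G-arr tripling-covers)
  in F , F-isFv , ≤-trans F≤order (≤-reflexive order≡3n∸f)
  where
  open Tripling A
  order≡3n∸f : order ≡ 3 * n ∸ f
  order≡3n∸f = trans (cong (λ c → n + (n + c)) (trans (∣∁p∣≡n∸∣p∣ A) (cong (n ∸_) ∣A∣≡f)))
                     (n+[n+[n∸f]]≡3*n∸f n (subst (_≤ n) ∣A∣≡f (∣p∣≤n A)))
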